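{- Let $n\geq 2$ be even. Then for each $1\leq k\leq 4$, the smallest size of a $k$-strong defining set of $B_n$ is $kn^2/4$.
   Context: $B_n$ is the Latin square of order $n$ with rows, columns and symbols indexed by $\mathbb{Z}_n$, given by $B_n=\{(i,j;i+j \bmod n): i,j\in\mathbb{Z}_n\}$ (triples are (row, column; symbol)). A partial Latin square (PLS) is an array in which some cells may be empty and each symbol occurs at most once per row and column. A Latin trade in a Latin square $L$ is a non-empty PLS $T\subseteq L$ for which there is a PLS $T'$ of the same order with $T\cap T'=\emptyset$, the same set of non-empty cells as $T$, and the same set of symbols as $T$ in each row and in each column. A defining set of $L$ is a subset of $L$ contained in no other Latin square of the same order. A defining set $D$ of $L$ is $k$-strong if $|D\cap T|\geq k$ for every Latin trade $T\subseteq L$. -}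

module Defs where

open import Data.Nat using (ℕ; zero; suc; _+_)
open import Data.Nat.DivMod using (_mod_)
open import Data.Fin using (Fin; toℕ)
open import Data.Fin.Properties using (_≟_)
open import Data.Maybe using (Maybe; just; nothing)
open import Data.List using (List; map)
open import Data.Nat.ListAction using (sum)
open import Data.List.Base using (allFin)
open import Data.Product using (_×_; Σ; ∃; ∃-syntax; _,_)
open import Relation.Binary.PropositionalEquality using (_≡_; _≢_)
open import Relation.Nullary using (¬_; yes; no)
open import Function.Bundles using (_⇔_)

-- A (possibly partial) array of order n: each cell (row i, column j)
-- is either empty (nothing) or holds one symbol (just s).
-- The triple (i , j ; s) belongs to the array P iff P i j ≡ just s.
Array : ℕ → Set
Array n = Fin n → Fin n → Maybe (Fin n)

IsPLS : ∀ {n} → Array n → Set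
IsPLS {n} P =
  (∀ (i j j' : Fin n) (s : Fin n) → P i j ≡ just s → P i j' ≡ just s → j ≡ j')
  × (∀ (i i' j : Fin n) (s : Fin n) → P i j ≡ just s → P i' j ≡ just s → i ≡ i')

IsLatinSquare : ∀ {n} → Array n → Set
IsLatinSquare {n} L = IsPLS L × (∀ (i j : Fin n) → ∃[ s ] (L i j ≡ just s))

_⊆ₐ_ : ∀ {n} → Array n → Array n → Set
_⊆ₐ_ {n} P Q = ∀ (i j s : Fin n) → P i j ≡ just s → Q i j ≡ just s

B : (n : ℕ) → Array n
B zero ()
B (suc m) i j = just ((toℕ i + toℕ j) mod (suc m))

meet : ∀ {n} → Maybe (Fin n) → Maybe (Fin n) → Maybe (Fin n)
meet (just s) (just t) with s ≟ t
... | yes _ = just s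
... | no _ = nothing
meet _ _ = nothing

_∩ₐ_ : ∀ {n} → Array n → Array n → Array n
(P ∩ₐ Q) i j = meet (P i j) (Q i j)

filled : ∀ {n} → Maybe (Fin n) → ℕ
filled (just _) = 1
filled nothing = 0

size : ∀ {n} → Array n → ℕ
size {n} P = sum (map (λ i → sum (map (λ j → filled (P i j)) (allFin n))) (allFin n))

IsLatinTrade : ∀ {n} → Array n → Array n → Set
IsLatinTrade {n} L T =
  IsPLS T × (T ⊆ₐ L) × (∃[ i ] ∃[ j ] ∃[ s ] (T i j ≡ just s)) ×
  Σ (Array n) (λ T' →
      IsPLS T'
    × (∀ (i j s : Fin n) → T i j ≡ just s → T' i j ≢ just s)
    × (∀ (i j : Fin n) → (∃[ s ] (T i j ≡ just s)) ⇔ (∃[ s ] (T' i j ≡ just s)))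
    × (∀ (i s : Fin n) → (∃[ j ] (T i j ≡ just s)) ⇔ (∃[ j ] (T' i j ≡ just s)))
    × (∀ (j s : Fin n) → (∃[ i ] (T i j ≡ just s)) ⇔ (∃[ i ] (T' i j ≡ just s))))

IsDefiningSet : ∀ {n} → Array n → Array n → Set
IsDefiningSet {n} L D =
  (D ⊆ₐ L) × (∀ (L' : Array n) → IsLatinSquare L' → D ⊆ₐ L' → ∀ (i j : Fin n) → L' i j ≡ L i j)

IsKStrongDefiningSet : ∀ {n} → ℕ → Array n → Array n → Set
IsKStrongDefiningSet {n} k L D =
  IsDefiningSet L D × (∀ (T : Array n) → IsLatinTrade L T → k Data.Nat.≤ size (D ∩ₐ T))

module Submission where

-- Write n = m + m.  The m² boxes {a , a + m} × {b , b + m} of B n are intercalates, i.e. pairwise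
-- disjoint Latin trades, so a k-strong defining set has at least k cells in each box: k m² cells.
-- Conversely, give the cell (u m + a , v m + b) (a , b < m, u , v ∈ {0 , 1}) the colour
-- (u xor c , v xor c), where c records whether a + b ≥ m.  Each box has one cell of each colour,
-- and translating a cell of colour (x , y) by (x m , y m) moves it into the corner triangles
-- a + b < m or a + b ≥ 3m.  Such a colour class D is forced cell by cell in order of decreasing
-- distance from the diagonal (after the translation): a rival symbol t in cell (i , j) already
-- occurs in row i or column j at a cell of D or at a cell farther from the diagonal.  The same
-- order shows that every Latin trade meets D, so the union of k colour classes is a k-strong
-- defining set with k m² cells.

open import Defs
open import Data.Bool using (Bool; true; false; if_then_else_; not; _∧_; _∨_; _xor_)
import Data.Bool.Properties as Bool
open import Data.Empty using (⊥-elim)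
open import Data.Fin using (Fin; zero; suc; toℕ; cast; _↑ˡ_; _↑ʳ_; punchIn; fromℕ<; splitAt; join)
open import Data.Fin.Properties
  using (_≟_; punchInᵢ≢i; cast-is-id; cast-involutive; toℕ-injective; toℕ-fromℕ<; toℕ<n; toℕ-cast;
         toℕ-↑ˡ; toℕ-↑ʳ; splitAt-join; join-splitAt)
open import Data.List using (List; []; _∷_; map; allFin; tabulate; length; take)
open import Data.List.Properties using (map-tabulate; map-cong; length-take)
open import Data.List.Relation.Unary.All using ([]; _∷_)
open import Data.List.Relation.Unary.All.Properties using (All¬⇒¬Any)
open import Data.List.Relation.Unary.AllPairs using ([]; _∷_)
open import Data.List.Relation.Unary.Any using (here)
open import Data.List.Relation.Unary.Unique.Propositional using (Unique)
open import Data.List.Relation.Unary.Unique.Propositional.Properties using (take⁺)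
open import Data.Maybe using (Maybe; just; nothing)
open import Data.Maybe.Properties using (just-injective)
open import Data.Nat hiding (_≟_)
open import Data.Nat.Divisibility using (_∣_; divides)
open import Data.Nat.DivMod
open import Data.Nat.Induction using (<-rec)
import Data.Nat.ListAction as List
open import Data.Nat.Properties hiding (_≟_)
open import Data.Nat.Tactic.RingSolver using (solve-∀)
open import Data.Product using (_×_; _,_; ∃-syntax; proj₁; proj₂; uncurry)
open import Data.Product.Properties using (≡-dec)
open import Data.Sum using (_⊎_; inj₁; inj₂; [_,_]′)
open import Function using (_∘_; id)
open import Function.Bundles using (_⇔_; module Equivalence; mk⇔)
open import Relation.Binary.Definitions using (DecidableEquality)
open import Relation.Binary.PropositionalEquality
open import Relation.Nullary using (¬_; yes; no; does; contradiction)
open import Relation.Nullary.Decidable using (dec-true; dec-false)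
open import Algebra.Properties.CommutativeSemigroup +-commutativeSemigroup using (interchange; x∙yz≈y∙xz)
open import Algebra.Properties.CommutativeMonoid.Sum +-0-commutativeMonoid
  using (sum; sum-syntax; sum-remove; sum-replicate-zero; ∑-distrib-+; sum-cong-≗)

-- Finite sums

∑-allFin : ∀ n (f : Fin n → ℕ) → List.sum (map f (allFin n)) ≡ ∑[ i < n ] f i
∑-allFin zero f = refl
∑-allFin (suc n) f = cong (f zero +_) (begin
  List.sum (map f (tabulate suc))   ≡⟨ cong List.sum (map-tabulate suc f) ⟩
  List.sum (tabulate (f ∘ suc))     ≡⟨ cong List.sum (sym (map-tabulate id (f ∘ suc))) ⟩
  List.sum (map (f ∘ suc) (allFin n)) ≡⟨ ∑-allFin n (f ∘ suc) ⟩
  ∑[ i < n ] f (suc i)              ∎)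
  where open ≡-Reasoning

∑-mono-≤ : ∀ {n} {f g : Fin n → ℕ} → (∀ i → f i ≤ g i) → ∑[ i < n ] f i ≤ ∑[ i < n ] g i
∑-mono-≤ {zero}  _   = z≤n
∑-mono-≤ {suc n} f≤g = +-mono-≤ (f≤g zero) (∑-mono-≤ (f≤g ∘ suc))

≤-∑ : ∀ {n} (f : Fin n → ℕ) i → f i ≤ ∑[ j < n ] f j
≤-∑ {suc n} f i = subst (f i ≤_) (sym (sum-remove {i = i} f)) (m≤m+n (f i) _)

∑-single : ∀ {n} (f : Fin n → ℕ) i → (∀ j → j ≢ i → f j ≡ 0) → ∑[ j < n ] f j ≡ f i
∑-single {suc n} f i off-i = begin
  sum f                               ≡⟨ sum-remove {i = i} f ⟩
  f i + sum (f ∘ punchIn i)           ≡⟨ cong (f i +_) (sum-cong-≗ (λ j → off-i (punchIn i j) (punchInᵢ≢i i j))) ⟩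
  f i + sum {n} (λ _ → 0)             ≡⟨ cong (f i +_) (sum-replicate-zero n) ⟩
  f i + 0                             ≡⟨ +-identityʳ (f i) ⟩
  f i                                 ∎
  where open ≡-Reasoning

∑-cast : ∀ {m n} (e : m ≡ n) (f : Fin n → ℕ) → ∑[ i < n ] f i ≡ ∑[ i < m ] f (cast e i)
∑-cast refl f = sum-cong-≗ (λ i → cong f (sym (cast-is-id refl i)))

∑-splitAt : ∀ a b (f : Fin (a + b) → ℕ) → ∑[ i < a + b ] f i ≡ ∑[ i < a ] f (i ↑ˡ b) + ∑[ i < b ] f (a ↑ʳ i)
∑-splitAt zero    b f = refl
∑-splitAt (suc a) b f = trans (cong (f zero +_) (∑-splitAt a b (f ∘ suc))) (sym (+-assoc (f zero) _ _))

∑-const : ∀ n c → ∑[ i < n ] c ≡ n * c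
∑-const zero    c = refl
∑-const (suc n) c = cong (c +_) (∑-const n c)

∑∑-const : ∀ m c → ∑[ a < m ] ∑[ b < m ] c ≡ m * (m * c)
∑∑-const m c = trans (sum-cong-≗ {m} (λ _ → ∑-const m c)) (∑-const m (m * c))

∑-if : ∀ {k} x (g : Fin k → ℕ) → ∑[ b < k ] (if x then g b else 0) ≡ (if x then ∑[ b < k ] g b else 0)
∑-if {k} true  g = refl
∑-if {k} false g = sum-replicate-zero k

∑-indicator : ∀ {k} (f : Fin k → ℕ) a → ∑[ a′ < k ] (if does (a′ ≟ a) then f a′ else 0) ≡ f a
∑-indicator f a = trans (∑-single _ a off-a) at-a
  where
  off-a : ∀ a′ → a′ ≢ a → (if does (a′ ≟ a) then f a′ else 0) ≡ 0
  off-a a′ a′≢a rewrite dec-false (a′ ≟ a) a′≢a = refl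
  at-a : (if does (a ≟ a) then f a else 0) ≡ f a
  at-a rewrite dec-true (a ≟ a) refl = refl

∑ᵇ : (Bool → ℕ) → ℕ
∑ᵇ f = f false + f true

∑ᵇ-cong : ∀ {f g : Bool → ℕ} → (∀ u → f u ≡ g u) → ∑ᵇ f ≡ ∑ᵇ g
∑ᵇ-cong f≡g = cong₂ _+_ (f≡g false) (f≡g true)

if-∧ : ∀ x y (t : ℕ) → (if x ∧ y then t else 0) ≡ (if x then (if y then t else 0) else 0)
if-∧ true  y t = refl
if-∧ false y t = refl

xor-cancel : ∀ u x → u xor (x xor u) ≡ x
xor-cancel false false = refl
xor-cancel false true  = refl
xor-cancel true  false = refl
xor-cancel true  true  = refl

-- Arrays as sets of triples

size-∑ : ∀ {n} (P : Array n) → size P ≡ ∑[ i < n ] ∑[ j < n ] filled (P i j)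
size-∑ {n} P = trans (cong List.sum (map-cong (λ i → ∑-allFin n _) (allFin n))) (∑-allFin n _)

size-mono-≤ : ∀ {n} {P Q : Array n} → (∀ i j → filled (P i j) ≤ filled (Q i j)) → size P ≤ size Q
size-mono-≤ {P = P} {Q} P≤Q = subst₂ _≤_ (sym (size-∑ P)) (sym (size-∑ Q)) (∑-mono-≤ (λ i → ∑-mono-≤ (P≤Q i)))

size-+ : ∀ {n} {P Q R : Array n} → (∀ i j → filled (P i j) ≡ filled (Q i j) + filled (R i j)) →
         size P ≡ size Q + size R
size-+ {n} {P} {Q} {R} P≡Q+R = begin
  size P                                            ≡⟨ size-∑ P ⟩
  ∑[ i < n ] ∑[ j < n ] filled (P i j)              ≡⟨ sum-cong-≗ (λ i → trans (sum-cong-≗ (P≡Q+R i))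
                                                                            (∑-distrib-+ (Q′ i) (R′ i))) ⟩
  ∑[ i < n ] (sum (Q′ i) + sum (R′ i))              ≡⟨ ∑-distrib-+ (sum ∘ Q′) (sum ∘ R′) ⟩
  ∑[ i < n ] sum (Q′ i) + ∑[ i < n ] sum (R′ i)     ≡⟨ cong₂ _+_ (size-∑ Q) (size-∑ R) ⟨
  size Q + size R                                   ∎
  where
  open ≡-Reasoning
  Q′ R′ : Fin n → Fin n → ℕ
  Q′ i j = filled (Q i j)
  R′ i j = filled (R i j)

just⇒1≤size : ∀ {n} (P : Array n) {i j s} → P i j ≡ just s → 1 ≤ size P
just⇒1≤size {n} P {i} {j} Pij≡s = begin
  1                                     ≡⟨ cong filled (sym Pij≡s) ⟩
  filled (P i j)                        ≤⟨ ≤-∑ (λ j → filled (P i j)) j ⟩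
  ∑[ j < n ] filled (P i j)             ≤⟨ ≤-∑ (λ i → ∑[ j < n ] filled (P i j)) i ⟩
  ∑[ i < n ] ∑[ j < n ] filled (P i j)  ≡⟨ sym (size-∑ P) ⟩
  size P                                ∎
  where open ≤-Reasoning

size-cong : ∀ {n} {P Q : Array n} → (∀ i j → filled (P i j) ≡ filled (Q i j)) → size P ≡ size Q
size-cong {P = P} {Q} P≡Q = trans (size-∑ P) (trans (sum-cong-≗ (λ i → sum-cong-≗ (P≡Q i))) (sym (size-∑ Q)))

size-empty : ∀ {n} → size {n} (λ _ _ → nothing) ≡ 0
size-empty {n} = trans (size-∑ {n} (λ _ _ → nothing))
                       (trans (sum-cong-≗ {n} (λ _ → sum-replicate-zero n)) (sum-replicate-zero n))

meet-diag : ∀ {n} (s : Fin n) → meet (just s) (just s) ≡ just s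
meet-diag s with s ≟ s
... | yes _  = refl
... | no s≢s = ⊥-elim (s≢s refl)

filled-meet-≤ˡ : ∀ {n} (x y : Maybe (Fin n)) → filled (meet x y) ≤ filled x
filled-meet-≤ˡ (just s) (just t) with s ≟ t
... | yes _ = ≤-refl
... | no _  = z≤n
filled-meet-≤ˡ (just s) nothing = z≤n
filled-meet-≤ˡ nothing  y       = z≤n

filled-meet-≤ʳ : ∀ {n} (x y : Maybe (Fin n)) → filled (meet x y) ≤ filled y
filled-meet-≤ʳ (just s) (just t) with s ≟ t
... | yes _ = ≤-refl
... | no _  = z≤n
filled-meet-≤ʳ (just s) nothing = z≤n
filled-meet-≤ʳ nothing  y       = z≤n

table : ∀ {n} → (Fin n → Fin n → Fin n) → Array n
table σ i j = just (σ i j)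

restrict : ∀ {n} → (Fin n → Fin n → Bool) → Array n → Array n
restrict p P i j = if p i j then P i j else nothing

module _ {n} (p : Fin n → Fin n → Bool) {P : Array n} where

  restrict-true : ∀ {i j} → p i j ≡ true → restrict p P i j ≡ P i j
  restrict-true pij rewrite pij = refl

  restrict-just : ∀ {i j s} → restrict p P i j ≡ just s → p i j ≡ true × P i j ≡ just s
  restrict-just {i} {j} eq with p i j
  ... | true = refl , eq

  restrict-false : ∀ {i j} → p i j ≡ false → restrict p P i j ≡ nothing
  restrict-false pij rewrite pij = refl

  restrict-⊆ : restrict p P ⊆ₐ P
  restrict-⊆ i j s eq = proj₂ (restrict-just eq)

  restrict-PLS : IsPLS P → IsPLS (restrict p P)
  restrict-PLS (rows , cols) =
    (λ i j j′ s e e′ → rows i j j′ s (restrict-⊆ i j s e) (restrict-⊆ i j′ s e′)) ,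
    (λ i i′ j s e e′ → cols i i′ j s (restrict-⊆ i j s e) (restrict-⊆ i′ j s e′))

table-PLS : ∀ {n} {σ : Fin n → Fin n → Fin n} →
            (∀ i {j j′} → σ i j ≡ σ i j′ → j ≡ j′) → (∀ j {i i′} → σ i j ≡ σ i′ j → i ≡ i′) →
            IsPLS (table σ)
table-PLS cancelˡ cancelʳ =
  (λ i j j′ s e e′ → cancelˡ i (just-injective (trans e (sym e′)))) ,
  (λ i i′ j s e e′ → cancelʳ j (just-injective (trans e (sym e′))))

restrict-table-just : ∀ {n} p {σ : Fin n → Fin n → Fin n} {i j s} →
                      restrict p (table σ) i j ≡ just s → p i j ≡ true × σ i j ≡ s
restrict-table-just p {σ} eq with restrict-just p {table σ} eq
... | pij , σij≡s = pij , just-injective σij≡s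

∩-restrict-≤ : ∀ {n} p (P Q : Array n) i j → filled ((P ∩ₐ restrict p Q) i j) ≤ filled (restrict p P i j)
∩-restrict-≤ p P Q i j with p i j
... | true  = filled-meet-≤ˡ (P i j) (Q i j)
... | false = filled-meet-≤ʳ (P i j) nothing

filled-if-∨ : ∀ {n} (x y : Bool) (s : Maybe (Fin n)) → (x ≡ true → y ≡ false) →
              filled (if x ∨ y then s else nothing) ≡
              filled (if x then s else nothing) + filled (if y then s else nothing)
filled-if-∨ true  true  s excl = contradiction (excl refl) (λ ())
filled-if-∨ true  false s excl = sym (+-identityʳ _)
filled-if-∨ false y     s excl = refl

size-restrict-∨ : ∀ {n} p q (P : Array n) → (∀ i j → p i j ≡ true → q i j ≡ false) →
                  size (restrict (λ i j → p i j ∨ q i j) P) ≡ size (restrict p P) + size (restrict q P)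
size-restrict-∨ p q P disjoint = size-+ (λ i j → filled-if-∨ (p i j) (q i j) (P i j) (disjoint i j))

filled-restrict-table : ∀ {n} p (σ : Fin n → Fin n → Fin n) i j →
                        filled (restrict p (table σ) i j) ≡ (if p i j then 1 else 0)
filled-restrict-table p σ i j with p i j
... | true  = refl
... | false = refl

restrict-∩ : ∀ {n} p (P Q : Array n) i j → filled ((restrict p P ∩ₐ Q) i j) ≡ filled (restrict p (P ∩ₐ Q) i j)
restrict-∩ p P Q i j with p i j
... | true  = refl
... | false = refl

module Colouring {n} {K : Set} (_≟ᴷ_ : DecidableEquality K) (χ : Fin n → Fin n → K) where
  open import Data.List.Membership.DecPropositional _≟ᴷ_ using (_∈?_; _∉_)

  class : K → Array n → Array n
  class c = restrict (λ i j → does (χ i j ≟ᴷ c))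

  classes : List K → Array n → Array n
  classes cs = restrict (λ i j → does (χ i j ∈? cs))

  size-classes-∷ : ∀ {c cs} P → c ∉ cs → size (classes (c ∷ cs) P) ≡ size (class c P) + size (classes cs P)
  size-classes-∷ {c} {cs} P c∉cs = size-restrict-∨ _ _ P disjoint
    where
    disjoint : ∀ i j → does (χ i j ≟ᴷ c) ≡ true → does (χ i j ∈? cs) ≡ false
    disjoint i j _ with χ i j ≟ᴷ c
    disjoint i j _  | yes refl = dec-false (c ∈? cs) c∉cs
    disjoint i j () | no _

  size-classes : ∀ {cs} P s → Unique cs → (∀ c → size (class c P) ≡ s) → size (classes cs P) ≡ length cs * s
  size-classes P s []          _    = size-empty {n}
  size-classes P s (c∉ ∷ uniq) size≡ =
    trans (size-classes-∷ P (All¬⇒¬Any c∉)) (cong₂ _+_ (size≡ _) (size-classes P s uniq size≡))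

  size-classes-≥ : ∀ {cs} P s → Unique cs → (∀ c → s ≤ size (class c P)) → length cs * s ≤ size (classes cs P)
  size-classes-≥ P s []          _    = z≤n
  size-classes-≥ P s (c∉ ∷ uniq) size≥ =
    subst (_ ≤_) (sym (size-classes-∷ P (All¬⇒¬Any c∉))) (+-mono-≤ (size≥ _) (size-classes-≥ P s uniq size≥))

module Forcing {n} (σ : Fin n → Fin n → Fin n) (inD : Fin n → Fin n → Bool) (rank : Fin n → Fin n → ℕ) where

  D : Array n
  D = restrict inD (table σ)

  Precedes : Fin n → Fin n → Fin n → Fin n → Set
  Precedes a b i j = inD a b ≡ true ⊎ rank a b < rank i j

  ForcingOrder : Set
  ForcingOrder = ∀ i j i₂ j₂ → σ i j₂ ≡ σ i₂ j → j₂ ≢ j → Precedes i j₂ i j ⊎ Precedes i₂ j i j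

  rank-induction : (P : Fin n → Fin n → Set) →
                   (∀ i j → (∀ a b → rank a b < rank i j → P a b) → P i j) → ∀ i j → P i j
  rank-induction P step i j = <-rec (λ r → ∀ i j → rank i j ≡ r → P i j)
    (λ { r IH i j refl → step i j (λ a b lt → IH lt a b refl) }) (rank i j) i j refl

  forcing-defining : (∀ i t → ∃[ j ] σ i j ≡ t) → (∀ j t → ∃[ i ] σ i j ≡ t) →
                     ForcingOrder → IsDefiningSet (table σ) D
  forcing-defining row-onto col-onto order = restrict-⊆ inD , agrees
    where
    agrees : ∀ L → IsLatinSquare L → D ⊆ₐ L → ∀ i j → L i j ≡ just (σ i j)
    agrees L ((rowsL , colsL) , L-full) D⊆L = rank-induction _ step
      where
      settled : ∀ {i j a b} → (∀ a b → rank a b < rank i j → L a b ≡ just (σ a b)) →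
                Precedes a b i j → L a b ≡ just (σ a b)
      settled IH (inj₁ ab∈D) = D⊆L _ _ _ (restrict-true inD {table σ} ab∈D)
      settled IH (inj₂ lt)   = IH _ _ lt

      step : ∀ i j → (∀ a b → rank a b < rank i j → L a b ≡ just (σ a b)) → L i j ≡ just (σ i j)
      step i j IH with L-full i j
      ... | t , Lij≡t with t ≟ σ i j
      ... | yes refl = Lij≡t
      ... | no t≢σij with row-onto i t | col-onto j t
      ... | j₂ , σij₂≡t | i₂ , σi₂j≡t
          with order i j i₂ j₂ (trans σij₂≡t (sym σi₂j≡t)) (λ j₂≡j → t≢σij (trans (sym σij₂≡t) (cong (σ i) j₂≡j)))
      ... | inj₁ prec = ⊥-elim (t≢σij (trans (sym σij₂≡t)
              (cong (σ i) (sym (rowsL i j j₂ t Lij≡t (trans (settled IH prec) (cong just σij₂≡t)))))))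
      ... | inj₂ prec = ⊥-elim (t≢σij (trans (sym σi₂j≡t)
              (cong (λ k → σ k j) (sym (colsL i i₂ j t Lij≡t (trans (settled IH prec) (cong just σi₂j≡t)))))))

  forcing-meets-trades : ForcingOrder → ∀ T → IsLatinTrade (table σ) T → 1 ≤ size (D ∩ₐ T)
  forcing-meets-trades order T
    (_ , T⊆L , (i₀ , j₀ , s₀ , T₀) , T′ , _ , disjoint , same-cells , same-rows , same-cols) =
    rank-induction Hit step i₀ j₀ s₀ T₀
    where
    open Equivalence
    Hit : Fin n → Fin n → Set
    Hit i j = ∀ s → T i j ≡ just s → 1 ≤ size (D ∩ₐ T)

    symbol : ∀ {a b s} → T a b ≡ just s → σ a b ≡ s
    symbol Tab≡s = just-injective (T⊆L _ _ _ Tab≡s)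

    hit : ∀ {i j a b} → (∀ a b → rank a b < rank i j → Hit a b) → Precedes a b i j → Hit a b
    hit {a = a} {b} IH (inj₁ ab∈D) s Tab≡s = just⇒1≤size (D ∩ₐ T) (begin
      meet (D a b) (T a b)       ≡⟨ cong₂ meet (restrict-true inD {table σ} ab∈D) Tab≡s ⟩
      meet (just (σ a b)) (just s) ≡⟨ cong (λ x → meet (just x) (just s)) (symbol Tab≡s) ⟩
      meet (just s) (just s)     ≡⟨ meet-diag s ⟩
      just s                     ∎)
      where open ≡-Reasoning
    hit IH (inj₂ lt) = IH _ _ lt

    step : ∀ i j → (∀ a b → rank a b < rank i j → Hit a b) → Hit i j
    step i j IH s Tij≡s with to (same-cells i j) (s , Tij≡s)
    ... | t , T′ij≡t with from (same-rows i t) (j , T′ij≡t) | from (same-cols j t) (i , T′ij≡t)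
    ... | j₂ , Tij₂≡t | i₂ , Ti₂j≡t with order i j i₂ j₂ (trans (symbol Tij₂≡t) (sym (symbol Ti₂j≡t))) j₂≢j
      where
      j₂≢j : j₂ ≢ j
      j₂≢j refl = disjoint i j s Tij≡s (trans T′ij≡t (cong just (just-injective (trans (sym Tij₂≡t) Tij≡s))))
    ... | inj₁ prec = hit IH prec t Tij₂≡t
    ... | inj₂ prec = hit IH prec t Ti₂j≡t

module Intercalate {n} (σ : Fin n → Fin n → Fin n)
  (cancelˡ : ∀ i {j j′} → σ i j ≡ σ i j′ → j ≡ j′) (cancelʳ : ∀ j {i i′} → σ i j ≡ σ i′ j → i ≡ i′)
  (φ : Fin n → Fin n) (φ-involutive : ∀ i → φ (φ i) ≡ i)
  (σ-φ : ∀ i j → σ i (φ j) ≡ σ (φ i) j) (σ-φ-≢ : ∀ i j → σ i (φ j) ≢ σ i j)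
  where

  swapped : Fin n → Fin n → Fin n
  swapped i j = σ i (φ j)

  φ-injective : ∀ {i i′} → φ i ≡ φ i′ → i ≡ i′
  φ-injective {i} {i′} eq = trans (sym (φ-involutive i)) (trans (cong φ eq) (φ-involutive i′))

  φ-closed-trade : ∀ p → (∀ i j → p (φ i) j ≡ p i j) → (∀ i j → p i (φ j) ≡ p i j) →
                   ∀ {i₀ j₀} → p i₀ j₀ ≡ true → IsLatinTrade (table σ) (restrict p (table σ))
  φ-closed-trade p closedʳ closedᶜ {i₀} {j₀} p₀ =
    restrict-PLS p (table-PLS cancelˡ cancelʳ) , restrict-⊆ p , (i₀ , j₀ , σ i₀ j₀ , inT p₀) ,
    restrict p (table swapped) ,
    restrict-PLS p (table-PLS (λ i eq → φ-injective (cancelˡ i eq)) (λ j → cancelʳ (φ j))) ,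
    disjoint , same-cells , same-rows , same-cols
    where
    T T′ : Array n
    T  = restrict p (table σ)
    T′ = restrict p (table swapped)

    inT : ∀ {i j} → p i j ≡ true → T i j ≡ just (σ i j)
    inT = restrict-true p {table σ}

    inT′ : ∀ {i j} → p i j ≡ true → T′ i j ≡ just (swapped i j)
    inT′ = restrict-true p {table swapped}

    fromT : ∀ {i j s} → T i j ≡ just s → p i j ≡ true × σ i j ≡ s
    fromT = restrict-table-just p {σ}

    fromT′ : ∀ {i j s} → T′ i j ≡ just s → p i j ≡ true × swapped i j ≡ s
    fromT′ = restrict-table-just p {swapped}

    disjoint : ∀ i j s → T i j ≡ just s → T′ i j ≢ just s
    disjoint i j s e e′ = σ-φ-≢ i j (trans (proj₂ (fromT′ e′)) (sym (proj₂ (fromT e))))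

    same-cells : ∀ i j → (∃[ s ] T i j ≡ just s) ⇔ (∃[ s ] T′ i j ≡ just s)
    same-cells i j = mk⇔
      (λ (s , e) → swapped i j , inT′ (proj₁ (fromT e)))
      (λ (s , e) → σ i j , inT (proj₁ (fromT′ e)))

    same-rows : ∀ i s → (∃[ j ] T i j ≡ just s) ⇔ (∃[ j ] T′ i j ≡ just s)
    same-rows i s = mk⇔
      (λ (j , e) → let pij , σij≡s = fromT e in
        φ j , trans (inT′ (trans (closedᶜ i j) pij)) (cong just (trans (cong (σ i) (φ-involutive j)) σij≡s)))
      (λ (j , e) → let pij , σiφj≡s = fromT′ e in
        φ j , trans (inT (trans (closedᶜ i j) pij)) (cong just σiφj≡s))

    same-cols : ∀ j s → (∃[ i ] T i j ≡ just s) ⇔ (∃[ i ] T′ i j ≡ just s)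
    same-cols j s = mk⇔
      (λ (i , e) → let pij , σij≡s = fromT e in
        φ i , trans (inT′ (trans (closedʳ i j) pij))
                (cong just (trans (σ-φ (φ i) j) (trans (cong (λ k → σ k j) (φ-involutive i)) σij≡s))))
      (λ (i , e) → let pij , σiφj≡s = fromT′ e in
        φ i , trans (inT (trans (closedʳ i j) pij)) (cong just (trans (sym (σ-φ i j)) σiφj≡s)))

-- Arithmetic modulo n

[m+n%d]%d≡[m+n]%d : ∀ x y d .{{_ : NonZero d}} → (x + y % d) % d ≡ (x + y) % d
[m+n%d]%d≡[m+n]%d x y d = begin
  (x + y % d) % d           ≡⟨ %-distribˡ-+ x (y % d) d ⟩
  (x % d + y % d % d) % d   ≡⟨ cong (λ z → (x % d + z) % d) (m%n%n≡m%n y d) ⟩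
  (x % d + y % d) % d       ≡⟨ %-distribˡ-+ x y d ⟨
  (x + y) % d               ∎
  where open ≡-Reasoning

module _ (n : ℕ) .{{_ : NonZero n}} where

  %-below-n+n : ∀ {z} → z < n + n → z % n ≡ z ⊎ z ≡ z % n + n
  %-below-n+n {z} z<2n with z <? n
  ... | yes z<n = inj₁ (m<n⇒m%n≡m z<n)
  ... | no z≮n = inj₂ (begin
    z               ≡⟨ m∸n+n≡m n≤z ⟨
    z ∸ n + n       ≡⟨ cong (_+ n) (m<n⇒m%n≡m z∸n<n) ⟨
    (z ∸ n) % n + n ≡⟨ cong (_+ n) (m≤n⇒[n∸m]%m≡n%m n≤z) ⟩
    z % n + n       ∎)
    where
    open ≡-Reasoning
    n≤z : n ≤ z
    n≤z = ≮⇒≥ z≮n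
    z∸n<n : z ∸ n < n
    z∸n<n = subst (z ∸ n <_) (m+n∸n≡m n n) (∸-monoˡ-< z<2n n≤z)

  %-wrap : ∀ {x y} → x < y → y < n + n → x % n ≡ y % n → y ≡ x + n
  %-wrap {x} {y} x<y y<2n x≡y with %-below-n+n (<-trans x<y y<2n) | %-below-n+n y<2n
  ... | inj₁ x≡r | inj₁ y≡r = contradiction (trans (sym x≡r) (trans x≡y y≡r)) (<⇒≢ x<y)
  ... | inj₁ x≡r | inj₂ y≡r+n = trans y≡r+n (cong (_+ n) (trans (sym x≡y) x≡r))
  ... | inj₂ x≡r+n | inj₁ y≡r = contradiction (subst₂ _≤_ (trans x≡y y≡r) (sym x≡r+n) (m≤m+n (x % n) n)) (<⇒≱ x<y)
  ... | inj₂ x≡r+n | inj₂ y≡r+n = contradiction (trans x≡r+n (trans (cong (_+ n) x≡y) (sym y≡r+n))) (<⇒≢ x<y)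

∣-∣-growʳ : ∀ {a b c} → a ≤ b → b < c → ∣ a - b ∣ < ∣ a - c ∣
∣-∣-growʳ a≤b b<c = subst₂ _<_ (sym (m≤n⇒∣m-n∣≡n∸m a≤b)) (sym (m≤n⇒∣m-n∣≡n∸m (≤-trans a≤b (<⇒≤ b<c))))
  (∸-monoˡ-< b<c a≤b)

∣-∣-growˡ : ∀ {a b c} → c < a → a ≤ b → ∣ a - b ∣ < ∣ c - b ∣
∣-∣-growˡ c<a a≤b = subst₂ _<_ (sym (m≤n⇒∣m-n∣≡n∸m a≤b)) (sym (m≤n⇒∣m-n∣≡n∸m (≤-trans (<⇒≤ c<a) a≤b)))
  (∸-monoʳ-< c<a a≤b)

∣-∣-≤ : ∀ {a b n} → a ≤ n → b ≤ n → ∣ a - b ∣ ≤ n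
∣-∣-≤ {a} {b} a≤n b≤n = ≤-trans (∣m-n∣≤m⊔n a b) (⊔-lub a≤n b≤n)

module Corners (n m : ℕ) .{{_ : NonZero n}} where

  InCorners : ℕ → ℕ → Set
  InCorners a b = a + b < m ⊎ n + m ≤ a + b

  Earlier : ℕ → ℕ → ℕ → ℕ → Set
  Earlier a′ b′ a b = InCorners a′ b′ ⊎ ∣ a - b ∣ < ∣ a′ - b′ ∣

  wrap-into-corners : ∀ {x y} → x < y → y < n + n → x % n ≡ y % n → x < m ⊎ n + m ≤ y
  wrap-into-corners {x} {y} x<y y<2n x≡y with x <? m
  ... | yes x<m = inj₁ x<m
  ... | no x≮m  = inj₂ (subst (n + m ≤_) (trans (+-comm n x) (sym (%-wrap n x<y y<2n x≡y))) (+-monoʳ-≤ n (≮⇒≥ x≮m)))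

  corners-order : ∀ {a b a₂ b₂} → a < n → b < n → a₂ < n → b₂ < n → (a + b₂) % n ≡ (a₂ + b) % n → b₂ ≢ b →
                  Earlier a b₂ a b ⊎ Earlier a₂ b a b
  corners-order {a} {b} {a₂} {b₂} a<n b<n a₂<n b₂<n same b₂≢b with ≤-total a b
  ... | inj₁ a≤b with b <? b₂ | a₂ <? a
  ...   | yes b<b₂ | _        = inj₁ (inj₂ (∣-∣-growʳ a≤b b<b₂))
  ...   | no _     | yes a₂<a = inj₂ (inj₂ (∣-∣-growˡ a₂<a a≤b))
  ...   | no b≮b₂  | no a₂≮a
    with wrap-into-corners (+-mono-≤-< (≮⇒≥ a₂≮a) (≤∧≢⇒< (≮⇒≥ b≮b₂) b₂≢b)) (+-mono-< a₂<n b<n) same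
  ...     | inj₁ left  = inj₁ (inj₁ (inj₁ left))
  ...     | inj₂ right = inj₂ (inj₁ (inj₂ right))
  corners-order {a} {b} {a₂} {b₂} a<n b<n a₂<n b₂<n same b₂≢b | inj₂ b≤a with a <? a₂ | b₂ <? b
  ...   | yes a<a₂ | _        = inj₂ (inj₂ (subst₂ _<_ (∣-∣-comm b a) (∣-∣-comm b a₂) (∣-∣-growʳ b≤a a<a₂)))
  ...   | no _     | yes b₂<b = inj₁ (inj₂ (subst₂ _<_ (∣-∣-comm b a) (∣-∣-comm b₂ a) (∣-∣-growˡ b₂<b b≤a)))
  ...   | no a≮a₂  | no b₂≮b
    with wrap-into-corners (+-mono-≤-< (≮⇒≥ a≮a₂) (≤∧≢⇒< (≮⇒≥ b₂≮b) (≢-sym b₂≢b))) (+-mono-< a<n b₂<n) (sym same)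
  ...     | inj₁ right = inj₂ (inj₁ (inj₁ right))
  ...     | inj₂ left  = inj₁ (inj₁ (inj₂ left))

module Cyclic (n′ : ℕ) where

  n : ℕ
  n = suc n′

  infixl 6 _⊕_
  _⊕_ : Fin n → Fin n → Fin n
  i ⊕ j = (toℕ i + toℕ j) mod n

  ⊖_ : Fin n → Fin n
  ⊖ i = (n ∸ toℕ i) mod n

  toℕ-⊕ : ∀ i j → toℕ (i ⊕ j) ≡ (toℕ i + toℕ j) % n
  toℕ-⊕ i j = toℕ-fromℕ< _

  ⊕-comm : ∀ i j → i ⊕ j ≡ j ⊕ i
  ⊕-comm i j = cong (_mod n) (+-comm (toℕ i) (toℕ j))

  ⊕-assoc : ∀ i j k → (i ⊕ j) ⊕ k ≡ i ⊕ (j ⊕ k)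
  ⊕-assoc i j k = toℕ-injective (begin
    toℕ ((i ⊕ j) ⊕ k)                  ≡⟨ toℕ-⊕ (i ⊕ j) k ⟩
    (toℕ (i ⊕ j) + toℕ k) % n          ≡⟨ cong (λ z → (z + toℕ k) % n) (toℕ-⊕ i j) ⟩
    ((toℕ i + toℕ j) % n + toℕ k) % n  ≡⟨ cong (_% n) (+-comm _ (toℕ k)) ⟩
    (toℕ k + (toℕ i + toℕ j) % n) % n  ≡⟨ [m+n%d]%d≡[m+n]%d (toℕ k) _ n ⟩
    (toℕ k + (toℕ i + toℕ j)) % n      ≡⟨ cong (_% n) (trans (+-comm (toℕ k) _) (+-assoc (toℕ i) _ _)) ⟩
    (toℕ i + (toℕ j + toℕ k)) % n      ≡⟨ [m+n%d]%d≡[m+n]%d (toℕ i) _ n ⟨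
    (toℕ i + (toℕ j + toℕ k) % n) % n  ≡⟨ cong (λ z → (toℕ i + z) % n) (toℕ-⊕ j k) ⟨
    (toℕ i + toℕ (j ⊕ k)) % n          ≡⟨ toℕ-⊕ i (j ⊕ k) ⟨
    toℕ (i ⊕ (j ⊕ k))                  ∎)
    where open ≡-Reasoning

  ⊕-identityˡ : ∀ i → zero ⊕ i ≡ i
  ⊕-identityˡ i = toℕ-injective (trans (toℕ-⊕ zero i) (m<n⇒m%n≡m (toℕ<n i)))

  ⊕-inverseˡ : ∀ i → ⊖ i ⊕ i ≡ zero
  ⊕-inverseˡ i = toℕ-injective (begin
    toℕ (⊖ i ⊕ i)                  ≡⟨ trans (toℕ-⊕ (⊖ i) i) (cong (_% n) (+-comm _ (toℕ i))) ⟩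
    (toℕ i + toℕ (⊖ i)) % n        ≡⟨ cong (λ z → (toℕ i + z) % n) (toℕ-fromℕ< _) ⟩
    (toℕ i + (n ∸ toℕ i) % n) % n  ≡⟨ [m+n%d]%d≡[m+n]%d (toℕ i) _ n ⟩
    (toℕ i + (n ∸ toℕ i)) % n      ≡⟨ cong (_% n) (m+[n∸m]≡n (<⇒≤ (toℕ<n i))) ⟩
    n % n                          ≡⟨ n%n≡0 n ⟩
    0                              ∎)
    where open ≡-Reasoning

  ⊖-⊕-cancel : ∀ i j → ⊖ i ⊕ (i ⊕ j) ≡ j
  ⊖-⊕-cancel i j = trans (sym (⊕-assoc (⊖ i) i j)) (trans (cong (_⊕ j) (⊕-inverseˡ i)) (⊕-identityˡ j))

  ⊕-⊖-cancel : ∀ i j → i ⊕ (⊖ i ⊕ j) ≡ j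
  ⊕-⊖-cancel i j = trans (sym (⊕-assoc i (⊖ i) j))
    (trans (cong (_⊕ j) (trans (⊕-comm i (⊖ i)) (⊕-inverseˡ i))) (⊕-identityˡ j))

  ⊕-cancelˡ : ∀ i {j j′} → i ⊕ j ≡ i ⊕ j′ → j ≡ j′
  ⊕-cancelˡ i {j} {j′} eq = trans (sym (⊖-⊕-cancel i j)) (trans (cong (⊖ i ⊕_) eq) (⊖-⊕-cancel i j′))

  ⊕-cancelʳ : ∀ j {i i′} → i ⊕ j ≡ i′ ⊕ j → i ≡ i′
  ⊕-cancelʳ j {i} {i′} eq = ⊕-cancelˡ j (trans (⊕-comm j i) (trans eq (⊕-comm i′ j)))

  ⊕-interchange : ∀ a b c d → (a ⊕ b) ⊕ (c ⊕ d) ≡ (a ⊕ c) ⊕ (b ⊕ d)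
  ⊕-interchange a b c d = begin
    (a ⊕ b) ⊕ (c ⊕ d) ≡⟨ ⊕-assoc a b (c ⊕ d) ⟩
    a ⊕ (b ⊕ (c ⊕ d)) ≡⟨ cong (a ⊕_) (⊕-assoc b c d) ⟨
    a ⊕ ((b ⊕ c) ⊕ d) ≡⟨ cong (λ x → a ⊕ (x ⊕ d)) (⊕-comm b c) ⟩
    a ⊕ ((c ⊕ b) ⊕ d) ≡⟨ cong (a ⊕_) (⊕-assoc c b d) ⟩
    a ⊕ (c ⊕ (b ⊕ d)) ≡⟨ ⊕-assoc a c (b ⊕ d) ⟨
    (a ⊕ c) ⊕ (b ⊕ d) ∎
    where open ≡-Reasoning

  translate-⊕ : ∀ s t {i j i₂ j₂} → i ⊕ j₂ ≡ i₂ ⊕ j → (s ⊕ i) ⊕ (t ⊕ j₂) ≡ (s ⊕ i₂) ⊕ (t ⊕ j)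
  translate-⊕ s t {i} {j} {i₂} {j₂} eq = begin
    (s ⊕ i) ⊕ (t ⊕ j₂)  ≡⟨ ⊕-interchange s i t j₂ ⟩
    (s ⊕ t) ⊕ (i ⊕ j₂)  ≡⟨ cong ((s ⊕ t) ⊕_) eq ⟩
    (s ⊕ t) ⊕ (i₂ ⊕ j)  ≡⟨ ⊕-interchange s t i₂ j ⟩
    (s ⊕ i₂) ⊕ (t ⊕ j)  ∎
    where open ≡-Reasoning

  ⊕-solveʳ : ∀ i t → ∃[ j ] i ⊕ j ≡ t
  ⊕-solveʳ i t = ⊖ i ⊕ t , ⊕-⊖-cancel i t

  ⊕-solveˡ : ∀ j t → ∃[ i ] i ⊕ j ≡ t
  ⊕-solveˡ j t = ⊖ j ⊕ t , trans (⊕-comm _ j) (⊕-⊖-cancel j t)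

module EvenOrder (n′ m : ℕ) (m+m≡n : m + m ≡ suc n′) where
  open Cyclic n′

  m≢0 : m ≢ 0
  m≢0 refl = 0≢1+n m+m≡n

  instance
    m-nonZero : NonZero m
    m-nonZero = ≢-nonZero m≢0

  offset : Bool → ℕ
  offset false = 0
  offset true  = m

  tag : Bool → Fin m → Fin m ⊎ Fin m
  tag false = inj₁
  tag true  = inj₂

  untag : Fin m ⊎ Fin m → Bool × Fin m
  untag = [ (false ,_) , (true ,_) ]′

  tag-untag : ∀ x → uncurry tag (untag x) ≡ x
  tag-untag (inj₁ _) = refl
  tag-untag (inj₂ _) = refl

  untag-tag : ∀ u a → untag (tag u a) ≡ (u , a)
  untag-tag false _ = refl
  untag-tag true  _ = refl

  half : Bool → Fin m → Fin n
  half u a = cast m+m≡n (join m m (tag u a))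

  unhalf : Fin n → Bool × Fin m
  unhalf i = untag (splitAt m (cast (sym m+m≡n) i))

  unhalf-half : ∀ u a → unhalf (half u a) ≡ (u , a)
  unhalf-half u a = begin
    untag (splitAt m (cast (sym m+m≡n) (half u a))) ≡⟨ cong (untag ∘ splitAt m) (cast-involutive _ m+m≡n _) ⟩
    untag (splitAt m (join m m (tag u a)))           ≡⟨ cong untag (splitAt-join m m (tag u a)) ⟩
    untag (tag u a)                                  ≡⟨ untag-tag u a ⟩
    (u , a)                                          ∎
    where open ≡-Reasoning

  half-unhalf : ∀ i → uncurry half (unhalf i) ≡ i
  half-unhalf i = begin
    cast m+m≡n (join m m (uncurry tag (untag x))) ≡⟨ cong (cast m+m≡n ∘ join m m) (tag-untag x) ⟩
    cast m+m≡n (join m m x)                       ≡⟨ cong (cast m+m≡n) (join-splitAt m m i′) ⟩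
    cast m+m≡n i′                                 ≡⟨ cast-involutive m+m≡n (sym m+m≡n) i ⟩
    i                                             ∎
    where
    open ≡-Reasoning
    i′ : Fin (m + m)
    i′ = cast (sym m+m≡n) i
    x : Fin m ⊎ Fin m
    x = splitAt m i′

  toℕ-half : ∀ u a → toℕ (half u a) ≡ offset u + toℕ a
  toℕ-half false a = trans (toℕ-cast m+m≡n (a ↑ˡ m)) (toℕ-↑ˡ a m)
  toℕ-half true  a = trans (toℕ-cast m+m≡n (m ↑ʳ a)) (toℕ-↑ʳ m a)

  m<n : m < n
  m<n = subst (m <_) m+m≡n (m<m+n m (>-nonZero⁻¹ m))

  halfway : Fin n
  halfway = fromℕ< m<n

  antipode : Fin n → Fin n
  antipode i = halfway ⊕ i

  toℕ-antipode : ∀ i → toℕ (antipode i) ≡ (m + toℕ i) % n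
  toℕ-antipode i = trans (toℕ-⊕ halfway i) (cong (λ z → (z + toℕ i) % n) (toℕ-fromℕ< m<n))

  antipode-half : ∀ u a → antipode (half u a) ≡ half (not u) a
  antipode-half u a = toℕ-injective (begin
    toℕ (antipode (half u a))    ≡⟨ toℕ-antipode (half u a) ⟩
    (m + toℕ (half u a)) % n     ≡⟨ cong (λ z → (m + z) % n) (toℕ-half u a) ⟩
    (m + (offset u + toℕ a)) % n ≡⟨ add-m u ⟩
    offset (not u) + toℕ a       ≡⟨ toℕ-half (not u) a ⟨
    toℕ (half (not u) a)         ∎)
    where
    open ≡-Reasoning
    add-m : ∀ u → (m + (offset u + toℕ a)) % n ≡ offset (not u) + toℕ a
    add-m false = m<n⇒m%n≡m (subst (m + toℕ a <_) m+m≡n (+-monoʳ-< m (toℕ<n a)))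
    add-m true  = begin
      (m + (m + toℕ a)) % n ≡⟨ cong (_% n) (trans (sym (+-assoc m m (toℕ a))) (cong (_+ toℕ a) m+m≡n)) ⟩
      (n + toℕ a) % n       ≡⟨ cong (_% n) (+-comm n (toℕ a)) ⟩
      (toℕ a + n) % n       ≡⟨ [m+n]%n≡m%n (toℕ a) n ⟩
      toℕ a % n             ≡⟨ m<n⇒m%n≡m (<-trans (toℕ<n a) m<n) ⟩
      toℕ a                 ∎

  antipode-involutive : ∀ i → antipode (antipode i) ≡ i
  antipode-involutive i = begin
    halfway ⊕ (halfway ⊕ i) ≡⟨ ⊕-assoc halfway halfway i ⟨
    antipode halfway ⊕ i    ≡⟨ cong (_⊕ i) halfway⊕halfway≡0 ⟩
    zero ⊕ i                ≡⟨ ⊕-identityˡ i ⟩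
    i                       ∎
    where
    open ≡-Reasoning
    halfway⊕halfway≡0 : antipode halfway ≡ zero
    halfway⊕halfway≡0 = toℕ-injective (begin
      toℕ (antipode halfway) ≡⟨ toℕ-antipode halfway ⟩
      (m + toℕ halfway) % n  ≡⟨ cong (λ z → (m + z) % n) (toℕ-fromℕ< m<n) ⟩
      (m + m) % n            ≡⟨ cong (_% n) m+m≡n ⟩
      n % n                  ≡⟨ n%n≡0 n ⟩
      0                      ∎)

  ⊕-antipode : ∀ i j → i ⊕ antipode j ≡ antipode i ⊕ j
  ⊕-antipode i j = trans (sym (⊕-assoc i halfway j)) (cong (_⊕ j) (⊕-comm i halfway))

  ⊕-antipode-≢ : ∀ i j → i ⊕ antipode j ≢ i ⊕ j
  ⊕-antipode-≢ i j eq = m≢0 (begin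
    m                      ≡⟨ toℕ-fromℕ< m<n ⟨
    toℕ halfway            ≡⟨ cong toℕ (⊕-cancelʳ j (trans (⊕-cancelˡ i eq) (sym (⊕-identityˡ j)))) ⟩
    0                      ∎)
    where open ≡-Reasoning

  ∑-halves : ∀ (f : Fin n → ℕ) → ∑[ i < n ] f i ≡ ∑[ a < m ] ∑ᵇ (λ u → f (half u a))
  ∑-halves f = begin
    ∑[ i < n ] f i                                            ≡⟨ ∑-cast m+m≡n f ⟩
    ∑[ i < m + m ] f (cast m+m≡n i)                           ≡⟨ ∑-splitAt m m (f ∘ cast m+m≡n) ⟩
    ∑[ a < m ] f (half false a) + ∑[ a < m ] f (half true a)  ≡⟨ ∑-distrib-+ (f ∘ half false) (f ∘ half true) ⟨
    ∑[ a < m ] ∑ᵇ (λ u → f (half u a))                        ∎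
    where open ≡-Reasoning

  boxSum : Array n → Fin m → Fin m → ℕ
  boxSum P a b = ∑ᵇ λ u → ∑ᵇ λ v → filled (P (half u a) (half v b))

  size-boxes : ∀ P → size P ≡ ∑[ a < m ] ∑[ b < m ] boxSum P a b
  size-boxes P = begin
    size P                                   ≡⟨ size-∑ P ⟩
    ∑[ i < n ] ∑[ j < n ] filled (P i j)     ≡⟨ sum-cong-≗ (λ i → ∑-halves (filled ∘ P i)) ⟩
    ∑[ i < n ] column i                      ≡⟨ ∑-halves column ⟩
    ∑[ a < m ] ∑ᵇ (λ u → sum (row u a))      ≡⟨ sum-cong-≗ (λ a → ∑-distrib-+ (row false a) (row true a)) ⟨
    ∑[ a < m ] ∑[ b < m ] boxSum P a b       ∎
    where
    open ≡-Reasoning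
    column : Fin n → ℕ
    column i = ∑[ b < m ] ∑ᵇ (λ v → filled (P i (half v b)))
    row : Bool → Fin m → Fin m → ℕ
    row u a b = ∑ᵇ λ v → filled (P (half u a) (half v b))

  box : Fin n → Fin m
  box i = proj₂ (unhalf i)

  box-half : ∀ u a → box (half u a) ≡ a
  box-half u a = cong proj₂ (unhalf-half u a)

  box-antipode : ∀ i → box (antipode i) ≡ box i
  box-antipode i = begin
    box (antipode i)                           ≡⟨ cong (box ∘ antipode) (half-unhalf i) ⟨
    box (antipode (uncurry half (unhalf i)))   ≡⟨ cong box (antipode-half (proj₁ (unhalf i)) (box i)) ⟩
    box (half (not (proj₁ (unhalf i))) (box i)) ≡⟨ box-half (not (proj₁ (unhalf i))) (box i) ⟩
    box i                                      ∎
    where open ≡-Reasoning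

  inBox : Fin m → Fin m → Fin n → Fin n → Bool
  inBox a b i j = does (box i ≟ a) ∧ does (box j ≟ b)

  module Antipodal = Intercalate _⊕_ ⊕-cancelˡ ⊕-cancelʳ antipode antipode-involutive ⊕-antipode ⊕-antipode-≢

  box-trade : ∀ a b → IsLatinTrade (B n) (restrict (inBox a b) (B n))
  box-trade a b = Antipodal.φ-closed-trade (inBox a b)
    (λ i j → cong (λ c → does (c ≟ a) ∧ does (box j ≟ b)) (box-antipode i))
    (λ i j → cong (λ c → does (box i ≟ a) ∧ does (c ≟ b)) (box-antipode j))
    (cong₂ _∧_ (dec-true (box (half false a) ≟ a) (box-half false a))
               (dec-true (box (half false b) ≟ b) (box-half false b)))

  boxSum-restrict : ∀ p P a b β → (∀ u v → p (half u a) (half v b) ≡ β) →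
                    boxSum (restrict p P) a b ≡ (if β then boxSum P a b else 0)
  boxSum-restrict p P a b true  p≡β = ∑ᵇ-cong (λ u → ∑ᵇ-cong (λ v → cong filled (restrict-true p {P} (p≡β u v))))
  boxSum-restrict p P a b false p≡β = ∑ᵇ-cong (λ u → ∑ᵇ-cong (λ v → cong filled (restrict-false p {P} (p≡β u v))))

  size-restrict-box : ∀ a b P → size (restrict (inBox a b) P) ≡ boxSum P a b
  size-restrict-box a b P = begin
    size (restrict (inBox a b) P)                                   ≡⟨ size-boxes _ ⟩
    ∑[ a′ < m ] ∑[ b′ < m ] boxSum (restrict (inBox a b) P) a′ b′   ≡⟨ sum-cong-≗ (λ a′ → sum-cong-≗ (in-box a′)) ⟩
    ∑[ a′ < m ] ∑[ b′ < m ] (if does (a′ ≟ a) then row a′ b′ else 0) ≡⟨ sum-cong-≗ (λ a′ → ∑-if _ (row a′)) ⟩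
    ∑[ a′ < m ] (if does (a′ ≟ a) then sum (row a′) else 0)         ≡⟨ ∑-indicator (sum ∘ row) a ⟩
    sum (row a)                                                     ≡⟨ ∑-indicator (boxSum P a) b ⟩
    boxSum P a b                                                    ∎
    where
    open ≡-Reasoning
    row : Fin m → Fin m → ℕ
    row a′ b′ = if does (b′ ≟ b) then boxSum P a′ b′ else 0
    in-box : ∀ a′ b′ → boxSum (restrict (inBox a b) P) a′ b′ ≡ (if does (a′ ≟ a) then row a′ b′ else 0)
    in-box a′ b′ = trans (boxSum-restrict (inBox a b) P a′ b′ _
                           (λ u v → cong₂ (λ c d → does (c ≟ a) ∧ does (d ≟ b)) (box-half u a′) (box-half v b′)))
                         (if-∧ (does (a′ ≟ a)) _ _)

  strong-lower-bound : ∀ k D → IsKStrongDefiningSet k (B n) D → k * (m * m) ≤ size D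
  strong-lower-bound k D (_ , strong) = begin
    k * (m * m)                          ≡⟨ trans (*-comm k (m * m)) (*-assoc m m k) ⟩
    m * (m * k)                          ≡⟨ ∑∑-const m k ⟨
    ∑[ a < m ] ∑[ b < m ] k              ≤⟨ ∑-mono-≤ (λ a → ∑-mono-≤ (λ b → k≤box a b)) ⟩
    ∑[ a < m ] ∑[ b < m ] boxSum D a b   ≡⟨ size-boxes D ⟨
    size D                               ∎
    where
    open ≤-Reasoning
    k≤box : ∀ a b → k ≤ boxSum D a b
    k≤box a b = begin
      k                                  ≤⟨ strong _ (box-trade a b) ⟩
      size (D ∩ₐ restrict (inBox a b) (B n)) ≤⟨ size-mono-≤ (∩-restrict-≤ (inBox a b) D (B n)) ⟩
      size (restrict (inBox a b) D)      ≡⟨ size-restrict-box a b D ⟩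
      boxSum D a b                       ∎

  open Corners n m

  Colour : Set
  Colour = Bool × Bool

  _≟ᶜ_ : DecidableEquality Colour
  _≟ᶜ_ = ≡-dec Bool._≟_ Bool._≟_

  band : Fin m → Fin m → Bool
  band a b = does (m ≤? toℕ a + toℕ b)

  -- The translation (x m , y m) moves (u m + a , v m + b) into the corners iff
  -- (x , y) = paint (u , a) (v , b).
  paint : Bool × Fin m → Bool × Fin m → Colour
  paint (u , a) (v , b) = u xor band a b , v xor band a b

  colour : Fin n → Fin n → Colour
  colour i j = paint (unhalf i) (unhalf j)

  colour-half : ∀ u a v b → colour (half u a) (half v b) ≡ (u xor band a b , v xor band a b)
  colour-half u a v b = cong₂ paint (unhalf-half u a) (unhalf-half v b)

  open Colouring _≟ᶜ_ colour

  one-colour-per-box : ∀ β c → ∑ᵇ (λ u → ∑ᵇ (λ v → if does ((u xor β , v xor β) ≟ᶜ c) then 1 else 0)) ≡ 1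
  one-colour-per-box false (false , false) = refl
  one-colour-per-box false (false , true)  = refl
  one-colour-per-box false (true  , false) = refl
  one-colour-per-box false (true  , true)  = refl
  one-colour-per-box true  (false , false) = refl
  one-colour-per-box true  (false , true)  = refl
  one-colour-per-box true  (true  , false) = refl
  one-colour-per-box true  (true  , true)  = refl

  size-class : ∀ c → size (class c (B n)) ≡ m * m
  size-class c = begin
    size (class c (B n))                             ≡⟨ size-boxes _ ⟩
    ∑[ a < m ] ∑[ b < m ] boxSum (class c (B n)) a b ≡⟨ sum-cong-≗ (λ a → sum-cong-≗ (per-box a)) ⟩
    ∑[ a < m ] ∑[ b < m ] 1                          ≡⟨ ∑∑-const m 1 ⟩
    m * (m * 1)                                      ≡⟨ cong (m *_) (*-identityʳ m) ⟩
    m * m                                            ∎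
    where
    open ≡-Reasoning
    per-box : ∀ a b → boxSum (class c (B n)) a b ≡ 1
    per-box a b = trans
      (∑ᵇ-cong λ u → ∑ᵇ-cong λ v →
        trans (filled-restrict-table (λ i j → does (colour i j ≟ᶜ c)) _⊕_ (half u a) (half v b))
              (cong (λ κ → if does (κ ≟ᶜ c) then 1 else 0) (colour-half u a v b)))
      (one-colour-per-box (band a b) c)

  translation : Bool → Fin n
  translation false = zero
  translation true  = halfway

  shift : Bool → Fin n → Fin n
  shift x i = translation x ⊕ i

  shift-half : ∀ x u a → shift x (half u a) ≡ half (x xor u) a
  shift-half false u a = ⊕-identityˡ (half u a)
  shift-half true  u a = antipode-half u a

  -- Cells farther from the diagonal, after the translation, have smaller rank and are forced first.
  cornerRank : Colour → Fin n → Fin n → ℕ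
  cornerRank (x , y) i j = n ∸ ∣ toℕ (shift x i) - toℕ (shift y j) ∣

  a+b<n : ∀ (a b : Fin m) → toℕ a + toℕ b < n
  a+b<n a b = subst (toℕ a + toℕ b <_) m+m≡n (+-mono-< (toℕ<n a) (toℕ<n b))

  not-in-corners : ∀ {s} (a b : Fin m) → s ≡ m + (toℕ a + toℕ b) → ¬ (s < m ⊎ n + m ≤ s)
  not-in-corners a b refl (inj₁ low)  = m+n≮m m _ low
  not-in-corners a b refl (inj₂ high) =
    <⇒≱ (subst (m + (toℕ a + toℕ b) <_) (+-comm m n) (+-monoʳ-< m (a+b<n a b))) high

  corners-offset≡band : ∀ u v (a b : Fin m) → InCorners (offset u + toℕ a) (offset v + toℕ b) →
                        u ≡ band a b × v ≡ band a b
  corners-offset≡band false false a b (inj₁ low) = let e = sym (dec-false (m ≤? _) (<⇒≱ low)) in e , e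
  corners-offset≡band false false a b (inj₂ high) =
    contradiction high (<⇒≱ (<-≤-trans (a+b<n a b) (m≤m+n n m)))
  corners-offset≡band false true  a b corner = ⊥-elim (not-in-corners a b (x∙yz≈y∙xz (toℕ a) m (toℕ b)) corner)
  corners-offset≡band true  false a b corner = ⊥-elim (not-in-corners a b (+-assoc m (toℕ a) (toℕ b)) corner)
  corners-offset≡band true  true  a b (inj₁ low) =
    contradiction low (≤⇒≯ (≤-trans (m≤m+n m (toℕ a)) (m≤m+n (m + toℕ a) (m + toℕ b))))
  corners-offset≡band true  true  a b (inj₂ high) = let e = sym (dec-true (m ≤? _) m≤a+b) in e , e
    where
    both-high : (m + toℕ a) + (m + toℕ b) ≡ n + (toℕ a + toℕ b)
    both-high = trans (interchange m (toℕ a) m (toℕ b)) (cong (_+ (toℕ a + toℕ b)) m+m≡n)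
    m≤a+b : m ≤ toℕ a + toℕ b
    m≤a+b = +-cancelˡ-≤ n m _ (subst (n + m ≤_) both-high high)

  corners⇒colour : ∀ x y i j → InCorners (toℕ (shift x i)) (toℕ (shift y j)) → colour i j ≡ (x , y)
  corners⇒colour x y i j = subst₂ (λ i j → InCorners (toℕ (shift x i)) (toℕ (shift y j)) → colour i j ≡ (x , y))
    (half-unhalf i) (half-unhalf j) (at-half (unhalf i) (unhalf j))
    where
    at-half : ∀ ((u , a) (v , b) : Bool × Fin m) →
              InCorners (toℕ (shift x (half u a))) (toℕ (shift y (half v b))) → colour (half u a) (half v b) ≡ (x , y)
    at-half (u , a) (v , b) corner
      rewrite shift-half x u a | shift-half y v b | toℕ-half (x xor u) a | toℕ-half (y xor v) b | colour-half u a v b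
      with corners-offset≡band (x xor u) (y xor v) a b corner
    ... | x⊕u≡β , y⊕v≡β = cong₂ _,_ (trans (cong (u xor_) (sym x⊕u≡β)) (xor-cancel u x))
                                    (trans (cong (v xor_) (sym y⊕v≡β)) (xor-cancel v y))

  earlier⇒precedes : ∀ {x y p i j i′ j′} → (∀ i j → colour i j ≡ (x , y) → p i j ≡ true) →
                     Earlier (toℕ (shift x i′)) (toℕ (shift y j′)) (toℕ (shift x i)) (toℕ (shift y j)) →
                     Forcing.Precedes _⊕_ p (cornerRank (x , y)) i′ j′ i j
  earlier⇒precedes {x} {y} {i′ = i′} {j′} colour⇒p (inj₁ corner) =
    inj₁ (colour⇒p i′ j′ (corners⇒colour x y i′ j′ corner))
  earlier⇒precedes {x} {y} {i′ = i′} {j′} colour⇒p (inj₂ farther) =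
    inj₂ (∸-monoʳ-< farther (∣-∣-≤ (<⇒≤ (toℕ<n (shift x i′))) (<⇒≤ (toℕ<n (shift y j′)))))

  corner-forcing : ∀ c p → (∀ i j → colour i j ≡ c → p i j ≡ true) → Forcing.ForcingOrder _⊕_ p (cornerRank c)
  corner-forcing (x , y) p colour⇒p i j i₂ j₂ eq j₂≢j
    with corners-order (toℕ<n (shift x i)) (toℕ<n (shift y j)) (toℕ<n (shift x i₂)) (toℕ<n (shift y j₂)) same b₂≢b
    where
    same : (toℕ (shift x i) + toℕ (shift y j₂)) % n ≡ (toℕ (shift x i₂) + toℕ (shift y j)) % n
    same = trans (sym (toℕ-⊕ (shift x i) (shift y j₂)))
             (trans (cong toℕ (translate-⊕ (translation x) (translation y) eq)) (toℕ-⊕ (shift x i₂) (shift y j)))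
    b₂≢b : toℕ (shift y j₂) ≢ toℕ (shift y j)
    b₂≢b e = j₂≢j (⊕-cancelˡ (translation y) (toℕ-injective e))
  ... | inj₁ earlier = inj₁ (earlier⇒precedes colour⇒p earlier)
  ... | inj₂ earlier = inj₂ (earlier⇒precedes colour⇒p earlier)

  open import Data.List.Membership.DecPropositional _≟ᶜ_ using (_∈?_)

  colours : List Colour
  colours = (false , false) ∷ (true , true) ∷ (false , true) ∷ (true , false) ∷ []

  colours-unique : Unique colours
  colours-unique = ((λ ()) ∷ (λ ()) ∷ (λ ()) ∷ []) ∷ ((λ ()) ∷ (λ ()) ∷ []) ∷ ((λ ()) ∷ []) ∷ [] ∷ []

  cornerSet : ℕ → Array n
  cornerSet k = classes (take k colours) (B n)

  cornerSet-defining : ∀ {k} → 1 ≤ k → IsDefiningSet (B n) (cornerSet k)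
  cornerSet-defining {suc k} _ = Forcing.forcing-defining _⊕_ inD (cornerRank (false , false)) ⊕-solveʳ ⊕-solveˡ
    (corner-forcing (false , false) inD first-colour)
    where
    inD : Fin n → Fin n → Bool
    inD i j = does (colour i j ∈? take (suc k) colours)
    first-colour : ∀ i j → colour i j ≡ (false , false) → inD i j ≡ true
    first-colour i j colour≡ff = dec-true (colour i j ∈? take (suc k) colours) (here colour≡ff)

  class-meets-trades : ∀ c T → IsLatinTrade (B n) T → 1 ≤ size (class c (B n ∩ₐ T))
  class-meets-trades c T trade = begin
    1                              ≤⟨ Forcing.forcing-meets-trades _⊕_ _ (cornerRank c) order T trade ⟩
    size (class c (B n) ∩ₐ T)      ≡⟨ size-cong (restrict-∩ _ (B n) T) ⟩
    size (class c (B n ∩ₐ T))      ∎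
    where
    open ≤-Reasoning
    order : Forcing.ForcingOrder _⊕_ (λ i j → does (colour i j ≟ᶜ c)) (cornerRank c)
    order = corner-forcing c _ (λ i j colour≡c → dec-true (colour i j ≟ᶜ c) colour≡c)

  length-take-colours : ∀ {k} → k ≤ 4 → length (take k colours) ≡ k
  length-take-colours {k} k≤4 = trans (length-take k colours) (m≤n⇒m⊓n≡m k≤4)

  cornerSet-strong : ∀ {k} → 1 ≤ k → k ≤ 4 → IsKStrongDefiningSet k (B n) (cornerSet k)
  cornerSet-strong {k} 1≤k k≤4 = cornerSet-defining 1≤k , λ T trade → begin
    k                                          ≡⟨ length-take-colours k≤4 ⟨
    length (take k colours)                    ≡⟨ *-identityʳ _ ⟨
    length (take k colours) * 1                ≤⟨ size-classes-≥ _ 1 (take⁺ k colours-unique) (meets T trade) ⟩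
    size (classes (take k colours) (B n ∩ₐ T)) ≡⟨ size-cong (restrict-∩ _ (B n) T) ⟨
    size (cornerSet k ∩ₐ T)                    ∎
    where
    open ≤-Reasoning
    meets : ∀ T → IsLatinTrade (B n) T → ∀ c → 1 ≤ size (class c (B n ∩ₐ T))
    meets T trade c = class-meets-trades c T trade

  size-cornerSet : ∀ {k} → k ≤ 4 → size (cornerSet k) ≡ k * (m * m)
  size-cornerSet {k} k≤4 = trans (size-classes (B n) (m * m) (take⁺ k colours-unique) size-class)
                                 (cong (_* (m * m)) (length-take-colours k≤4))

theorem4 : (n : ℕ) → 2 ≤ n → 2 ∣ n → (k : ℕ) → 1 ≤ k → k ≤ 4 →
    (∃[ D ] (IsKStrongDefiningSet k (B n) D × size D ≡ (k * (n * n)) / 4))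
    × (∀ D → IsKStrongDefiningSet k (B n) D → (k * (n * n)) / 4 ≤ size D)
theorem4 (suc n′) _ (divides m n≡m*2) k 1≤k k≤4 =
  (cornerSet k , cornerSet-strong 1≤k k≤4 , trans (size-cornerSet k≤4) (sym quarter)) ,
  λ D strong → subst (_≤ size D) (sym quarter) (strong-lower-bound k D strong)
  where
  m+m≡n : m + m ≡ suc n′
  m+m≡n = trans (sym (m*2≡m+m m)) (sym n≡m*2)
    where
    m*2≡m+m : ∀ m → m * 2 ≡ m + m
    m*2≡m+m = solve-∀
  open EvenOrder n′ m m+m≡n
  quarter : (k * (suc n′ * suc n′)) / 4 ≡ k * (m * m)
  quarter = begin
    (k * (suc n′ * suc n′)) / 4   ≡⟨ cong (λ x → (k * (x * x)) / 4) (sym m+m≡n) ⟩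
    (k * ((m + m) * (m + m))) / 4 ≡⟨ cong (_/ 4) (regroup k m) ⟩
    (k * (m * m)) * 4 / 4         ≡⟨ m*n/n≡m (k * (m * m)) 4 ⟩
    k * (m * m)                   ∎
    where
    open ≡-Reasoning
    regroup : ∀ k m → k * ((m + m) * (m + m)) ≡ (k * (m * m)) * 4
    regroup = solve-∀
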